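{- Let $\Sigma$ be a finite set, $a:A\to(\mathbf 1+A)^\Sigma$ a $\Sigma$-detector and $x\in A$. Then $\mathcal C_a(x)$ is a safety constraint.
   Context: $\Sigma^{\mathbb N}$ is the set of streams over $\Sigma$; $s[m:]$ is the stream $k\mapsto s(k+m)$ and $s[0:m]$ the prefix of length $m$. $\mathbf 1=\{\Downarrow\}$, $+$ disjoint union. A safety constraint is a set $S\subseteq\Sigma^{\mathbb N}$ such that every $s\in\Sigma^{\mathbb N}$ with the property that for each $m\in\mathbb N$ there is $s'\in S$ with $s'[0:m]=s[0:m]$ belongs to $S$. A $\Sigma$-detector is a map $a:A\to(\mathbf 1+A)^\Sigma$. $[s]$ is the system with state set $\{s[k:]\mid k\in\mathbb N\}$, output $t\mapsto t(0)$, transition $t\mapsto t[1:]$. For such a system $\sigma=\langle\mathrm{out}_\sigma,\mathrm{tr}_\sigma\rangle$, $\mathrm{Join}(\sigma,a)(q,y)=\Downarrow$ if $a(y)(\mathrm{out}_\sigma q)=\Downarrow$ and $(\mathrm{tr}_\sigma q,a(y)(\mathrm{out}_\sigma q))$ otherwise. For $g:G\to\mathbf 1+G$: $g^{(1)}=g$, $g^{(k+1)}(z)=\Downarrow$ if $g^{(k)}(z)=\Downarrow$, else $g(g^{(k)}(z))$. $\mathcal C_a(x)=\{s\in\Sigma^{\mathbb N}\mid \mathrm{Join}([s],a)^{(k)}(s,x)\ne\Downarrow\text{ for all }k\ge1\}$. -}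

module Defs where

open import Data.Nat using (ℕ; zero; suc; _+_; _<_)
open import Data.Nat.Properties using (+-suc)
import Data.Nat.Properties
open import Data.Product using (Σ; ∃; _×_; _,_; proj₁; proj₂)
open import Data.Sum using (_⊎_; inj₁; inj₂)
open import Data.Unit using (⊤; tt)
open import Data.Fin using (Fin)
open import Function.Bundles using (_↔_)
open import Relation.Binary.PropositionalEquality using (_≡_; refl; trans; sym)
open import Relation.Nullary using (¬_)

One+ : Set → Set
One+ X = ⊤ ⊎ X

⇓ : {X : Set} → One+ X
⇓ = inj₁ tt

IsFinite : Set → Set
IsFinite S = ∃ λ n → S ↔ Fin n

Stream : Set → Set
Stream S = ℕ → S

drop : {S : Set} → Stream S → ℕ → Stream S
drop s m k = s (k + m)

SamePrefix : {S : Set} → ℕ → Stream S → Stream S → Set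
SamePrefix m s s' = ∀ i → i < m → s i ≡ s' i

IsSafety : {S : Set} → (Stream S → Set) → Set
IsSafety {S} C =
  ∀ (s : Stream S) →
    (∀ m → Σ (Stream S) λ s' → C s' × SamePrefix m s' s) → C s

Detector : Set → Set → Set
Detector S A = A → S → One+ A

record System (S : Set) (Q : Set) : Set where
  field
    out : Q → S
    tr  : Q → Q
open System public

-- the state set of [s]: { s[k:] | k ∈ ℕ }  (streams pointwise equal to some s[k:])
StreamState : {S : Set} → Stream S → Set
StreamState {S} s = Σ (Stream S) λ t → ∃ λ k → ∀ i → t i ≡ drop s k i

start : {S : Set} (s : Stream S) → StreamState s
start s = s , 0 , λ i → cong-s i
  where
  cong-s : ∀ i → s i ≡ s (i + 0)
  cong-s i rewrite Data.Nat.Properties.+-identityʳ i = refl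

streamSys : {S : Set} (s : Stream S) → System S (StreamState s)
streamSys s = record
  { out = λ q → proj₁ q 0
  ; tr  = λ { (t , k , p) → (λ i → t (suc i)) , suc k ,
              (λ i → trans (p (suc i)) (sym (cong′ i k))) } }
  where
  cong′ : ∀ i k → s (i + suc k) ≡ s (suc i + k)
  cong′ i k rewrite +-suc i k = refl

Join : {S Q A : Set} → System S Q → Detector S A → Q × A → One+ (Q × A)
Join σ a (q , y) with a y (out σ q)
... | inj₁ _  = ⇓
... | inj₂ y' = inj₂ (tr σ q , y')

-- g^(k) for k ≥ 1, indexed so that pow g (suc k) = g^(k+1) and pow g 0 = identity
pow : {G : Set} → (G → One+ G) → ℕ → G → One+ G
pow g zero z = inj₂ z
pow g (suc k) z with pow g k z
... | inj₁ _  = ⇓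
... | inj₂ z' = g z'

𝒞 : {S A : Set} → Detector S A → A → Stream S → Set
𝒞 a x s = ∀ k → ¬ (pow (Join (streamSys s) a) (suc k) (start s , x) ≡ ⇓)

module Submission where

-- The run of the detector a from x along a stream s halts after k steps or
-- not depending only on the first k letters of s, because the joined system
-- Join([s], a) reads exactly one letter per step.  Hence if s lies outside
-- 𝒞_a(x), i.e. the run halts after k+1 steps, then so does the run along every
-- stream sharing the prefix s[0:k+1]; no such stream lies in 𝒞_a(x), so s is
-- not a limit of members of 𝒞_a(x).

open import Defs
open import Data.Nat using (ℕ; zero; suc; _<_; _≤_)
open import Data.Nat.Properties using (<⇒≤; ≤-refl)
open import Data.Product using (_×_; _,_; proj₁; proj₂)
open import Data.Sum using (inj₁; inj₂)
open import Relation.Binary.PropositionalEquality using (_≡_; refl; sym; cong; module ≡-Reasoning)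

data SameFate {G H : Set} (R : G → H → Set) : One+ G → One+ H → Set where
  halted  : SameFate R ⇓ ⇓
  running : ∀ {z w} → R z w → SameFate R (inj₂ z) (inj₂ w)

halts-together : {G H : Set} {R : G → H → Set} {u : One+ G} {v : One+ H} →
  SameFate R u v → u ≡ ⇓ → v ≡ ⇓
halts-together halted refl = refl
halts-together (running _) ()

pow-lockstep : {G H : Set} (g : G → One+ G) (h : H → One+ H)
  (R : ℕ → G → H → Set) (n : ℕ) →
  (∀ {k z w} → k < n → R k z w → SameFate (R (suc k)) (g z) (h w)) →
  ∀ {z w} → R 0 z w → ∀ k → k ≤ n → SameFate (R k) (pow g k z) (pow h k w)
pow-lockstep g h R n step r₀ zero _ = running r₀
pow-lockstep g h R n step {z} {w} r₀ (suc k) k<n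
  with pow g k z | pow h k w | pow-lockstep g h R n step r₀ k (<⇒≤ k<n)
... | _ | _ | halted     = halted
... | _ | _ | running rₖ = step k<n rₖ

module _ {S A : Set} (a : Detector S A) where

  position : (s : Stream S) → StreamState s → ℕ
  position s q = proj₁ (proj₂ q)

  out-position : (s : Stream S) (q : StreamState s) →
    out (streamSys s) q ≡ s (position s q)
  out-position s q = proj₂ (proj₂ q) 0

  Synced : (s s' : Stream S) → ℕ → StreamState s × A → StreamState s' × A → Set
  Synced s s' k (q , y) (q' , y') = position s q ≡ k × position s' q' ≡ k × y ≡ y'

  same-letter-read : (s s' : Stream S) (k : ℕ) → s k ≡ s' k →
    (q : StreamState s) (q' : StreamState s') → position s q ≡ k → position s' q' ≡ k →
    out (streamSys s) q ≡ out (streamSys s') q'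
  same-letter-read s s' k agree q q' refl refl = begin
    out (streamSys s) q    ≡⟨ out-position s q ⟩
    s (position s q)       ≡⟨ agree ⟩
    s' (position s' q')    ≡⟨ sym (out-position s' q') ⟩
    out (streamSys s') q'  ∎
    where open ≡-Reasoning

  join-synced : (s s' : Stream S) (k : ℕ) → s k ≡ s' k →
    ∀ {z w} → Synced s s' k z w →
    SameFate (Synced s s' (suc k)) (Join (streamSys s) a z) (Join (streamSys s') a w)
  join-synced s s' k agree {q , y} {q' , .y} (pos , pos' , refl)
    with a y (out (streamSys s) q) | a y (out (streamSys s') q')
       | cong (a y) (same-letter-read s s' k agree q q' pos pos')
  ... | inj₁ _ | _ | refl = halted
  ... | inj₂ _ | _ | refl = running (cong suc pos , cong suc pos' , refl)

  halting-depends-on-prefix : (x : A) {s s' : Stream S} (m : ℕ) →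
    SamePrefix m s' s → ∀ k → k ≤ m →
    pow (Join (streamSys s) a) k (start s , x) ≡ ⇓ →
    pow (Join (streamSys s') a) k (start s' , x) ≡ ⇓
  halting-depends-on-prefix x {s} {s'} m agree k k≤m =
    halts-together (pow-lockstep (Join (streamSys s) a) (Join (streamSys s') a)
      (Synced s s') m (λ {k} k<m → join-synced s s' k (sym (agree k k<m)))
      (refl , refl , refl) k k≤m)

lemma5 : (S : Set) → IsFinite S → (A : Set) (a : Detector S A) (x : A) →
    IsSafety (𝒞 a x)
lemma5 S _ A a x s approximable k halts with approximable (suc k)
... | s' , s'∈𝒞 , agree =
  s'∈𝒞 k (halting-depends-on-prefix a x (suc k) agree (suc k) ≤-refl halts)
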